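{- Let $R$, $C$, $S$ be pairwise disjoint finite sets, $V=R\cup C\cup S$, and let $W$ be a partial latin square on $(R,C,S)$. Suppose $W$ embeds in some abelian group. Let $\mathcal{A}_W$ be the abelian group generated by $V$ subject to the relations $r+c+s=0$ for all $\{r,c,s\}\in W$, let $\nu:\mathcal{A}_W\to\mathbb{Z}\oplus\mathbb{Z}$ be the homomorphism with $\nu(r)=(1,0)$ for $r\in R$, $\nu(c)=(0,1)$ for $c\in C$ and $\nu(s)=(-1,-1)$ for $s\in S$, and let $\mathcal{C}_W=\ker\nu$. Then every minimal abelian representation $A$ of $W$ is isomorphic to a quotient of $\mathcal{C}_W$.
   Context: A partial latin square on $(R,C,S)$ is a set $W$ of triples $\{r,c,s\}$ with $r\in R$, $c\in C$, $s\in S$, such that any two elements from distinct sets among $R,C,S$ lie together in at most one triple of $W$. An embedding of $W$ in an abelian group $A$ is a function $f:V\to A$ whose restrictions to each of $R$, $C$, $S$ are injective and such that $f(r)+f(c)+f(s)=0$ for all $\{r,c,s\}\in W$; $W$ embeds in $A$ if such an $f$ exists. An abelian group $A$ is a minimal abelian representation of $W$ if $W$ embeds in $A$ and, for every embedding $f$ of $W$ in $A$, the image $f(V)$ generates $A$. (The map $\nu$ is well defined since each relation $r+c+s$ maps to $0$.) -}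

module Defs where

open import Level using (Level; _⊔_; 0ℓ) renaming (suc to lsuc)
open import Algebra.Bundles using (AbelianGroup; RawGroup)
open import Algebra.Structures using (IsAbelianGroup; IsGroup; IsMonoid; IsSemigroup; IsMagma)
open import Algebra.Morphism.Structures using (module GroupMorphisms)
import Algebra.Morphism.GroupMonomorphism as GMono
import Algebra.Properties.AbelianGroup as AGProps
import Algebra.Properties.CommutativeSemigroup as CSProps
import Algebra.Construct.Pointwise as Pointwise
open import Data.Product using (Σ; ∃; _×_; _,_; proj₁; proj₂)
open import Data.Sum using (_⊎_; inj₁; inj₂)
open import Data.Bool using (if_then_else_)
open import Data.Fin using (Fin; zero; suc; _≟_)
open import Data.Nat using (ℕ)
open import Data.Integer using (ℤ; 0ℤ; 1ℤ; _+_; -_; _-_)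
import Data.Integer.Properties as ℤP
open import Data.Integer.Tactic.RingSolver using (solve-∀)
open import Relation.Nullary.Decidable using (⌊_⌋)
open import Relation.Binary.PropositionalEquality using (_≡_)
import Relation.Binary.PropositionalEquality as Eq
import Relation.Binary.Reasoning.Setoid as SetoidReasoning

module _ {a ℓ} (G : AbelianGroup a ℓ) where
  open AbelianGroup G

  record Subgroup (p : Level) : Set (a ⊔ ℓ ⊔ lsuc p) where
    field
      P    : Carrier → Set p
      resp : ∀ {x y} → x ≈ y → P x → P y
      ε∈   : P ε
      ∙∈   : ∀ {x y} → P x → P y → P (x ∙ y)
      ⁻¹∈  : ∀ {x} → P x → P (x ⁻¹)

  data Gen {i} {I : Set i} (g : I → Carrier) : Carrier → Set (a ⊔ ℓ ⊔ i) where
    base : ∀ j → Gen g (g j)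
    unit : Gen g ε
    mul  : ∀ {x y} → Gen g x → Gen g y → Gen g (x ∙ y)
    inv  : ∀ {x} → Gen g x → Gen g (x ⁻¹)
    resp : ∀ {x y} → x ≈ y → Gen g x → Gen g y

  genSubgroup : ∀ {i} {I : Set i} (g : I → Carrier) → Subgroup (a ⊔ ℓ ⊔ i)
  genSubgroup g = record
    { P = Gen g ; resp = resp ; ε∈ = unit ; ∙∈ = mul ; ⁻¹∈ = inv }

  Generates : ∀ {i} {I : Set i} (g : I → Carrier) → Set (a ⊔ ℓ ⊔ i)
  Generates g = ∀ x → Gen g x

  module _ {p} (N : Subgroup p) where
    private
      open Subgroup N renaming (resp to Nresp)
      open AGProps G
      open CSProps commutativeSemigroup using (interchange)
      open SetoidReasoning setoid

      _≈N_ : Carrier → Carrier → Set p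
      x ≈N y = P (x ∙ y ⁻¹)

      embed : ∀ {x y} → x ≈ y → x ≈N y
      embed x≈y = Nresp (sym (x≈y⇒x∙y⁻¹≈ε x≈y)) ε∈

      symN : ∀ {x y} → x ≈N y → y ≈N x
      symN {x} {y} h = Nresp (⁻¹-anti-homo‿- x y) (⁻¹∈ h)

      transN : ∀ {x y z} → x ≈N y → y ≈N z → x ≈N z
      transN {x} {y} {z} h k = Nresp eq (∙∈ h k)
        where
        eq : (x ∙ y ⁻¹) ∙ (y ∙ z ⁻¹) ≈ x ∙ z ⁻¹
        eq = begin
          (x ∙ y ⁻¹) ∙ (y ∙ z ⁻¹)  ≈⟨ assoc x (y ⁻¹) (y ∙ z ⁻¹) ⟩
          x ∙ (y ⁻¹ ∙ (y ∙ z ⁻¹))  ≈⟨ ∙-congˡ (sym (assoc (y ⁻¹) y (z ⁻¹))) ⟩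
          x ∙ ((y ⁻¹ ∙ y) ∙ z ⁻¹)  ≈⟨ ∙-congˡ (∙-congʳ (inverseˡ y)) ⟩
          x ∙ (ε ∙ z ⁻¹)           ≈⟨ ∙-congˡ (identityˡ (z ⁻¹)) ⟩
          x ∙ z ⁻¹                 ∎

      congN : ∀ {x y u v} → x ≈N y → u ≈N v → (x ∙ u) ≈N (y ∙ v)
      congN {x} {y} {u} {v} h k = Nresp eq (∙∈ h k)
        where
        eq : (x ∙ y ⁻¹) ∙ (u ∙ v ⁻¹) ≈ (x ∙ u) ∙ (y ∙ v) ⁻¹
        eq = begin
          (x ∙ y ⁻¹) ∙ (u ∙ v ⁻¹)  ≈⟨ interchange x (y ⁻¹) u (v ⁻¹) ⟩
          (x ∙ u) ∙ (y ⁻¹ ∙ v ⁻¹)  ≈⟨ ∙-congˡ (⁻¹-∙-comm y v) ⟩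
          (x ∙ u) ∙ (y ∙ v) ⁻¹     ∎

      invN : ∀ {x y} → x ≈N y → (x ⁻¹) ≈N (y ⁻¹)
      invN {x} {y} h = Nresp (trans (sym (⁻¹-∙-comm x (y ⁻¹))) refl) (⁻¹∈ h)

    quotient : AbelianGroup a p
    quotient = record
      { Carrier = Carrier
      ; _≈_ = _≈N_
      ; _∙_ = _∙_
      ; ε = ε
      ; _⁻¹ = _⁻¹
      ; isAbelianGroup = record
        { isGroup = record
          { isMonoid = record
            { isSemigroup = record
              { isMagma = record
                { isEquivalence = record
                  { refl = embed refl ; sym = symN ; trans = transN }
                ; ∙-cong = congN
                }
              ; assoc = λ x y z → embed (assoc x y z)
              }
            ; identity = (λ x → embed (identityˡ x)) , (λ x → embed (identityʳ x))
            }
          ; inverse = (λ x → embed (inverseˡ x)) , (λ x → embed (inverseʳ x))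
          ; ⁻¹-cong = invN
          }
        ; comm = λ x y → embed (comm x y)
        }
      }

  subgroupOn : ∀ {p} (P : Carrier → Set p) → P ε →
               (∀ {x y} → P x → P y → P (x ∙ y)) →
               (∀ {x} → P x → P (x ⁻¹)) → AbelianGroup (a ⊔ p) ℓ
  subgroupOn {p} P ε∈ ∙∈ ⁻¹∈ = record
    { Carrier = Σ Carrier P
    ; _≈_ = λ x y → proj₁ x ≈ proj₁ y
    ; _∙_ = λ x y → (proj₁ x ∙ proj₁ y) , ∙∈ (proj₂ x) (proj₂ y)
    ; ε = ε , ε∈
    ; _⁻¹ = λ x → (proj₁ x ⁻¹) , ⁻¹∈ (proj₂ x)
    ; isAbelianGroup = GMono.isAbelianGroup mono isAbelianGroup
    }
    where
    raw : RawGroup (a ⊔ p) ℓ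
    raw = record
      { Carrier = Σ Carrier P
      ; _≈_ = λ x y → proj₁ x ≈ proj₁ y
      ; _∙_ = λ x y → (proj₁ x ∙ proj₁ y) , ∙∈ (proj₂ x) (proj₂ y)
      ; ε = ε , ε∈
      ; _⁻¹ = λ x → (proj₁ x ⁻¹) , ⁻¹∈ (proj₂ x)
      }
    mono : GroupMorphisms.IsGroupMonomorphism raw rawGroup proj₁
    mono = record
      { isGroupHomomorphism = record
        { isMonoidHomomorphism = record
          { isMagmaHomomorphism = record
            { isRelHomomorphism = record { cong = λ e → e }
            ; homo = λ _ _ → refl
            }
          ; ε-homo = refl
          }
        ; ⁻¹-homo = λ _ → refl
        }
      ; injective = λ e → e
      }

module _ (nR nC nS : ℕ) where

  V : Set
  V = Fin nR ⊎ Fin nC ⊎ Fin nS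

  Triples : Set₁
  Triples = Fin nR → Fin nC → Fin nS → Set

  IsPartialLatinSquare : Triples → Set
  IsPartialLatinSquare W =
    ∀ {r c s r′ c′ s′} → W r c s → W r′ c′ s′ →
    ((r ≡ r′ × c ≡ c′) ⊎ (r ≡ r′ × s ≡ s′) ⊎ (c ≡ c′ × s ≡ s′)) →
    r ≡ r′ × c ≡ c′ × s ≡ s′

  module _ (W : Triples) where

    record IsEmbedding {a ℓ} (A : AbelianGroup a ℓ)
                       (f : V → AbelianGroup.Carrier A) : Set (a ⊔ ℓ) where
      open AbelianGroup A
      field
        injR : ∀ r r′ → f (inj₁ r) ≈ f (inj₁ r′) → r ≡ r′
        injC : ∀ c c′ → f (inj₂ (inj₁ c)) ≈ f (inj₂ (inj₁ c′)) → c ≡ c′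
        injS : ∀ s s′ → f (inj₂ (inj₂ s)) ≈ f (inj₂ (inj₂ s′)) → s ≡ s′
        rel  : ∀ {r c s} → W r c s →
               (f (inj₁ r) ∙ f (inj₂ (inj₁ c))) ∙ f (inj₂ (inj₂ s)) ≈ ε

    EmbedsIn : ∀ {a ℓ} (A : AbelianGroup a ℓ) → Set (a ⊔ ℓ)
    EmbedsIn A = Σ (V → AbelianGroup.Carrier A) (IsEmbedding A)

    IsMinimalRepresentation : ∀ {a ℓ} (A : AbelianGroup a ℓ) → Set (a ⊔ ℓ)
    IsMinimalRepresentation A =
      EmbedsIn A × (∀ f → IsEmbedding A f → Generates A f)

    ℤ^V : AbelianGroup 0ℓ 0ℓ
    ℤ^V = Pointwise.abelianGroup V ℤP.+-0-abelianGroup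

    δ : ∀ {n} → Fin n → Fin n → ℤ
    δ i j = if ⌊ i ≟ j ⌋ then 1ℤ else 0ℤ

    relVec : Σ (Fin nR × Fin nC × Fin nS)
               (λ t → W (proj₁ t) (proj₁ (proj₂ t)) (proj₂ (proj₂ t))) → V → ℤ
    relVec ((r , c , s) , _) (inj₁ r′)        = δ r r′
    relVec ((r , c , s) , _) (inj₂ (inj₁ c′)) = δ c c′
    relVec ((r , c , s) , _) (inj₂ (inj₂ s′)) = δ s s′

    𝒜 : AbelianGroup 0ℓ 0ℓ
    𝒜 = quotient ℤ^V (genSubgroup ℤ^V relVec)

    Σℤ : ∀ n → (Fin n → ℤ) → ℤ
    Σℤ ℕ.zero    f = 0ℤ
    Σℤ (ℕ.suc n) f = f zero + Σℤ n (λ i → f (suc i))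

    ν : (V → ℤ) → ℤ × ℤ
    ν x = ( Σℤ nR (λ r → x (inj₁ r)) - Σℤ nS (λ s → x (inj₂ (inj₂ s)))
          , Σℤ nC (λ c → x (inj₂ (inj₁ c))) - Σℤ nS (λ s → x (inj₂ (inj₂ s))) )

    Ker : (V → ℤ) → Set
    Ker x = ν x ≡ (0ℤ , 0ℤ)

    private
      Σ-+ : ∀ n (f g : Fin n → ℤ) → Σℤ n (λ i → f i + g i) ≡ Σℤ n f + Σℤ n g
      Σ-+ ℕ.zero f g = Eq.refl
      Σ-+ (ℕ.suc n) f g =
        Eq.trans (Eq.cong (f zero + g zero +_) (Σ-+ n (λ i → f (suc i)) (λ i → g (suc i))))
              (lem (f zero) (g zero) (Σℤ n (λ i → f (suc i))) (Σℤ n (λ i → g (suc i))))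
        where
        lem : ∀ a b c d → (a + b) + (c + d) ≡ (a + c) + (b + d)
        lem = solve-∀

      Σ-neg : ∀ n (f : Fin n → ℤ) → Σℤ n (λ i → - f i) ≡ - Σℤ n f
      Σ-neg ℕ.zero f = Eq.refl
      Σ-neg (ℕ.suc n) f =
        Eq.trans (Eq.cong (- f zero +_) (Σ-neg n (λ i → f (suc i))))
              (Eq.sym (ℤP.neg-distrib-+ (f zero) (Σℤ n (λ i → f (suc i)))))

      Σ-0 : ∀ n → Σℤ n (λ _ → 0ℤ) ≡ 0ℤ
      Σ-0 ℕ.zero = Eq.refl
      Σ-0 (ℕ.suc n) = Eq.trans (ℤP.+-identityˡ _) (Σ-0 n)

      lemAdd : ∀ a b c d → a - c ≡ 0ℤ → b - d ≡ 0ℤ → (a + b) - (c + d) ≡ 0ℤ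
      lemAdd a b c d p q = Eq.trans (lem a b c d) (Eq.cong₂ _+_ p q)
        where
        lem : ∀ a b c d → (a + b) - (c + d) ≡ (a - c) + (b - d)
        lem = solve-∀

      lemNeg : ∀ a c → a - c ≡ 0ℤ → (- a) - (- c) ≡ 0ℤ
      lemNeg a c p = Eq.trans (lem a c) (Eq.cong -_ p)
        where
        lem : ∀ a c → (- a) - (- c) ≡ - (a - c)
        lem = solve-∀

      pair≡ : ∀ {p q : ℤ × ℤ} → p ≡ q → proj₁ p ≡ proj₁ q × proj₂ p ≡ proj₂ q
      pair≡ Eq.refl = Eq.refl , Eq.refl

      Ker-ε : Ker (λ _ → 0ℤ)
      Ker-ε rewrite Σ-0 nR | Σ-0 nC | Σ-0 nS = Eq.refl

      Ker-∙ : ∀ {x y} → Ker x → Ker y → Ker (λ v → x v + y v)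
      Ker-∙ {x} {y} kx ky =
        Eq.cong₂ _,_
          (Eq.trans (Eq.cong₂ _-_ (Σ-+ nR xr yr) (Σ-+ nS xs ys))
                    (lemAdd (Σℤ nR xr) (Σℤ nR yr) (Σℤ nS xs) (Σℤ nS ys)
                            (proj₁ (pair≡ kx)) (proj₁ (pair≡ ky))))
          (Eq.trans (Eq.cong₂ _-_ (Σ-+ nC xc yc) (Σ-+ nS xs ys))
                    (lemAdd (Σℤ nC xc) (Σℤ nC yc) (Σℤ nS xs) (Σℤ nS ys)
                            (proj₂ (pair≡ kx)) (proj₂ (pair≡ ky))))
        where
        xr = λ r → x (inj₁ r)
        yr = λ r → y (inj₁ r)
        xc = λ c → x (inj₂ (inj₁ c))
        yc = λ c → y (inj₂ (inj₁ c))
        xs = λ s → x (inj₂ (inj₂ s))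
        ys = λ s → y (inj₂ (inj₂ s))

      Ker-⁻¹ : ∀ {x} → Ker x → Ker (λ v → - x v)
      Ker-⁻¹ {x} kx =
        Eq.cong₂ _,_
          (Eq.trans (Eq.cong₂ _-_ (Σ-neg nR xr) (Σ-neg nS xs))
                    (lemNeg (Σℤ nR xr) (Σℤ nS xs) (proj₁ (pair≡ kx))))
          (Eq.trans (Eq.cong₂ _-_ (Σ-neg nC xc) (Σ-neg nS xs))
                    (lemNeg (Σℤ nC xc) (Σℤ nS xs) (proj₂ (pair≡ kx))))
        where
        xr = λ r → x (inj₁ r)
        xc = λ c → x (inj₂ (inj₁ c))
        xs = λ s → x (inj₂ (inj₂ s))

    𝒞 : AbelianGroup 0ℓ 0ℓ
    𝒞 = subgroupOn 𝒜 Ker Ker-ε (λ {x} {y} → Ker-∙ {x} {y}) (λ {x} → Ker-⁻¹ {x})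

module Submission where

-- Let f : V → A be an embedding of W.  Sending an integer vector x ∈ ℤ^V
-- to ψ x = Σ_v x(v) · f(v) is a homomorphism ℤ^V → A; it kills every
-- relation vector r + c + s because f is an embedding, so it descends to
-- 𝒜_W and restricts to 𝒞_W = ker ν.  By the first isomorphism theorem it
-- then suffices to show that ψ maps 𝒞_W onto A.  For this, translate f by
-- α⁻¹ on R, β⁻¹ on C and α ∙ β on S.  This is again an embedding, hence by
-- minimality generates A.  Choosing α ≈ f r₀ and β ≈ f c₀ (with a
-- substitute built from some s₀ ∈ S when R or C is empty), every translated
-- value is ψ of a vector of ν-degree (0,0), i.e. lies in ψ(𝒞_W), and so
-- ψ(𝒞_W) = A.

open import Defs
open import Level using (Level; _⊔_)
open import Data.Nat using (ℕ; zero; suc)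
open import Data.Product using (Σ; _×_; _,_; proj₁; proj₂)
open import Algebra.Bundles using (AbelianGroup)
open import Algebra.Morphism.Structures using (module GroupMorphisms)

import Data.Nat as ℕ
import Data.Nat.Properties as ℕP
import Data.Integer
open import Data.Integer as ℤ using (ℤ; +_; -[1+_]; _⊖_; 0ℤ; 1ℤ)
import Data.Integer.Properties as ℤP
open import Data.Integer.Tactic.RingSolver using (solve-∀)
open import Data.Fin using (Fin; zero; suc; _≟_)
open import Data.Sum using (inj₁; inj₂)
open import Data.Empty using (⊥-elim)
open import Relation.Nullary using (Dec; yes; no)
open import Function using (_∘_)
import Algebra.Properties.Group as GroupProperties
import Algebra.Properties.AbelianGroup as AbelianGroupProperties
import Algebra.Properties.Monoid.Mult as MonoidMultiples
import Algebra.Properties.CommutativeMonoid.Sum as CommutativeMonoidSums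
import Algebra.Properties.CommutativeSemigroup as CommutativeSemigroupProperties
import Algebra.Solver.CommutativeMonoid as CommutativeMonoidSolver
open import Relation.Binary.PropositionalEquality as ≡ using (_≡_)
import Relation.Binary.Reasoning.Setoid as SetoidReasoning

module _ {a ℓ} (G : AbelianGroup a ℓ) where
  open AbelianGroup G

  Gen-least : ∀ {p i} {I : Set i} {g : I → Carrier} (N : Subgroup G p) →
              (∀ j → Subgroup.P N (g j)) → ∀ {x} → Gen G g x → Subgroup.P N x
  Gen-least N g∈N (base j)   = g∈N j
  Gen-least N g∈N unit       = Subgroup.ε∈ N
  Gen-least N g∈N (mul x y)  = Subgroup.∙∈ N (Gen-least N g∈N x) (Gen-least N g∈N y)
  Gen-least N g∈N (inv x)    = Subgroup.⁻¹∈ N (Gen-least N g∈N x)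
  Gen-least N g∈N (resp e x) = Subgroup.resp N e (Gen-least N g∈N x)

module _ {a ℓ b ℓ′} (G : AbelianGroup a ℓ) (A : AbelianGroup b ℓ′) where
  private module G = AbelianGroup G
  open AbelianGroup A
  open GroupProperties group using (∙-cancelˡ; inverseˡ-unique)
  open GroupMorphisms G.rawGroup rawGroup
  open SetoidReasoning setoid

  mkGroupHomomorphism : ∀ {h : G.Carrier → Carrier} →
    (∀ {x y} → x G.≈ y → h x ≈ h y) → (∀ x y → h (x G.∙ y) ≈ h x ∙ h y) →
    IsGroupHomomorphism h
  mkGroupHomomorphism {h} cong homo = record
    { isMonoidHomomorphism = record
      { isMagmaHomomorphism = record
        { isRelHomomorphism = record { cong = cong }
        ; homo = homo
        }
      ; ε-homo = ε-homo
      }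
    ; ⁻¹-homo = ⁻¹-homo
    }
    where
    ε-homo : h G.ε ≈ ε
    ε-homo = ∙-cancelˡ (h G.ε) (h G.ε) ε (begin
      h G.ε ∙ h G.ε    ≈⟨ homo G.ε G.ε ⟨
      h (G.ε G.∙ G.ε)  ≈⟨ cong (G.identityˡ G.ε) ⟩
      h G.ε            ≈⟨ identityʳ (h G.ε) ⟨
      h G.ε ∙ ε        ∎)

    ⁻¹-homo : ∀ x → h (x G.⁻¹) ≈ h x ⁻¹
    ⁻¹-homo x = inverseˡ-unique (h (x G.⁻¹)) (h x) (begin
      h (x G.⁻¹) ∙ h x    ≈⟨ homo (x G.⁻¹) x ⟨
      h (x G.⁻¹ G.∙ x)    ≈⟨ cong (G.inverseˡ x) ⟩
      h G.ε               ≈⟨ ε-homo ⟩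
      ε                   ∎)

  module _ {h : G.Carrier → Carrier} (hom : IsGroupHomomorphism h) where
    open IsGroupHomomorphism hom
    open GroupProperties group using (x∙y⁻¹≈ε⇒x≈y; x≈y⇒x∙y⁻¹≈ε; ε⁻¹≈ε)

    homo-quotient : ∀ x y → h (x G.∙ y G.⁻¹) ≈ h x ∙ h y ⁻¹
    homo-quotient x y = trans (homo x (y G.⁻¹)) (∙-congˡ (⁻¹-homo y))

    kernel : Subgroup G ℓ′
    kernel = record
      { P    = λ x → h x ≈ ε
      ; resp = λ x≈y hx≈ε → trans (sym (⟦⟧-cong x≈y)) hx≈ε
      ; ε∈   = ε-homo
      ; ∙∈   = λ {x} {y} hx≈ε hy≈ε → trans (homo x y) (trans (∙-cong hx≈ε hy≈ε) (identityˡ ε))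
      ; ⁻¹∈  = λ {x} hx≈ε → trans (⁻¹-homo x) (trans (⁻¹-cong hx≈ε) ε⁻¹≈ε)
      }

    kernel⇒≈ : ∀ {x y} → h (x G.∙ y G.⁻¹) ≈ ε → h x ≈ h y
    kernel⇒≈ {x} {y} k = x∙y⁻¹≈ε⇒x≈y (h x) (h y) (trans (sym (homo-quotient x y)) k)

    ≈⇒kernel : ∀ {x y} → h x ≈ h y → h (x G.∙ y G.⁻¹) ≈ ε
    ≈⇒kernel {x} {y} e = trans (homo-quotient x y) (x≈y⇒x∙y⁻¹≈ε e)

    descend : ∀ {p} (N : Subgroup G p) → (∀ {x} → Subgroup.P N x → h x ≈ ε) →
              GroupMorphisms.IsGroupHomomorphism
                (AbelianGroup.rawGroup (quotient G N)) rawGroup h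
    descend N N⊆kernel = record
      { isMonoidHomomorphism = record
        { isMagmaHomomorphism = record
          { isRelHomomorphism = record { cong = λ x≈y → kernel⇒≈ (N⊆kernel x≈y) }
          ; homo = homo
          }
        ; ε-homo = ε-homo
        }
      ; ⁻¹-homo = ⁻¹-homo
      }

    firstIsomorphism : (∀ y → Σ G.Carrier λ x → h x ≈ y) →
      GroupMorphisms.IsGroupIsomorphism
        (AbelianGroup.rawGroup (quotient G kernel)) rawGroup h
    firstIsomorphism surj = record
      { isGroupMonomorphism = record
        { isGroupHomomorphism = descend kernel (λ k → k)
        ; injective = ≈⇒kernel
        }
      ; surjective = λ y → proj₁ (surj y) , λ z≈x → trans (kernel⇒≈ z≈x) (proj₂ (surj y))
      }

module Multiples {a ℓ} (A : AbelianGroup a ℓ) where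
  open AbelianGroup A
  open MonoidMultiples monoid using (×-congˡ; ×-homo-+) renaming (_×_ to _⨯_)
  open AbelianGroupProperties A using (⁻¹-∙-comm)
  open GroupProperties group using (ε⁻¹≈ε)
  open CommutativeMonoidSolver commutativeMonoid using (solve; _⊕_; _⊜_)
  open SetoidReasoning setoid

  infixr 8 _·_
  _·_ : ℤ → Carrier → Carrier
  (+ n)    · g = n ⨯ g
  -[1+ n ] · g = (suc n ⨯ g) ⁻¹

  cancel-common : ∀ g x y → (g ∙ x) ∙ (g ∙ y) ⁻¹ ≈ x ∙ y ⁻¹
  cancel-common g x y = begin
    (g ∙ x) ∙ (g ∙ y) ⁻¹         ≈⟨ ∙-congˡ (⁻¹-∙-comm g y) ⟨
    (g ∙ x) ∙ (g ⁻¹ ∙ y ⁻¹)      ≈⟨ solve 4 (λ g x g′ y′ → (g ⊕ x) ⊕ (g′ ⊕ y′) ⊜ (g ⊕ g′) ⊕ (x ⊕ y′))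
                                       refl g x (g ⁻¹) (y ⁻¹) ⟩
    (g ∙ g ⁻¹) ∙ (x ∙ y ⁻¹)      ≈⟨ ∙-congʳ (inverseʳ g) ⟩
    ε ∙ (x ∙ y ⁻¹)               ≈⟨ identityˡ _ ⟩
    x ∙ y ⁻¹                     ∎

  ⊖-· : ∀ m n g → (m ⊖ n) · g ≈ m ⨯ g ∙ (n ⨯ g) ⁻¹
  ⊖-· m zero g rewrite ℤP.⊖-≥ {m} {zero} ℕ.z≤n =
    sym (trans (∙-congˡ ε⁻¹≈ε) (identityʳ _))
  ⊖-· zero (suc n) g rewrite ℤP.⊖-≤ {zero} {suc n} ℕ.z≤n = sym (identityˡ _)
  ⊖-· (suc m) (suc n) g rewrite ℤP.[1+m]⊖[1+n]≡m⊖n m n =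
    trans (⊖-· m n g) (sym (cancel-common g (m ⨯ g) (n ⨯ g)))

  ·-homo-+ : ∀ m n g → (m ℤ.+ n) · g ≈ m · g ∙ n · g
  ·-homo-+ (+ m)    (+ n)    g = ×-homo-+ g m n
  ·-homo-+ (+ m)    -[1+ n ] g = ⊖-· m (suc n) g
  ·-homo-+ -[1+ m ] (+ n)    g = trans (⊖-· n (suc m) g) (comm _ _)
  ·-homo-+ -[1+ m ] -[1+ n ] g = begin
    (suc (suc (m ℕ.+ n)) ⨯ g) ⁻¹      ≈⟨ ⁻¹-cong (×-congˡ (≡.cong suc (≡.sym (ℕP.+-suc m n)))) ⟩
    ((suc m ℕ.+ suc n) ⨯ g) ⁻¹         ≈⟨ ⁻¹-cong (×-homo-+ g (suc m) (suc n)) ⟩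
    (suc m ⨯ g ∙ suc n ⨯ g) ⁻¹         ≈⟨ ⁻¹-∙-comm (suc m ⨯ g) (suc n ⨯ g) ⟨
    (suc m ⨯ g) ⁻¹ ∙ (suc n ⨯ g) ⁻¹    ∎

module Coordinates (nR nC nS : ℕ) (W : Triples nR nC nS) where
  open Data.Integer using (_+_; -_; _-_)

  δ′ : ∀ {n} → Fin n → Fin n → ℤ
  δ′ = δ nR nC nS W

  Σ′ : ∀ n → (Fin n → ℤ) → ℤ
  Σ′ = Σℤ nR nC nS W

  ν′ : (V nR nC nS → ℤ) → ℤ × ℤ
  ν′ = ν nR nC nS W

  δ-suc : ∀ {n} (j i : Fin n) → δ′ (suc j) (suc i) ≡ δ′ j i
  δ-suc j i with j ≟ i
  ... | yes _ = ≡.refl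
  ... | no _  = ≡.refl

  basis : V nR nC nS → V nR nC nS → ℤ
  basis (inj₁ r)        (inj₁ r′)        = δ′ r r′
  basis (inj₂ (inj₁ c)) (inj₂ (inj₁ c′)) = δ′ c c′
  basis (inj₂ (inj₂ s)) (inj₂ (inj₂ s′)) = δ′ s s′
  basis (inj₁ _)        (inj₂ _)         = 0ℤ
  basis (inj₂ (inj₁ _)) (inj₁ _)         = 0ℤ
  basis (inj₂ (inj₁ _)) (inj₂ (inj₂ _))  = 0ℤ
  basis (inj₂ (inj₂ _)) (inj₁ _)         = 0ℤ
  basis (inj₂ (inj₂ _)) (inj₂ (inj₁ _))  = 0ℤ

  infixl 6 _⊕_
  _⊕_ : ℤ × ℤ → ℤ × ℤ → ℤ × ℤ
  (p , q) ⊕ (p′ , q′) = (p + p′ , q + q′)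

  ⊝_ : ℤ × ℤ → ℤ × ℤ
  ⊝ (p , q) = (- p , - q)

  degree : V nR nC nS → ℤ × ℤ
  degree (inj₁ _)        = (1ℤ , 0ℤ)
  degree (inj₂ (inj₁ _)) = (0ℤ , 1ℤ)
  degree (inj₂ (inj₂ _)) = (- 1ℤ , - 1ℤ)

  Σ-+ : ∀ n (f g : Fin n → ℤ) → Σ′ n (λ i → f i + g i) ≡ Σ′ n f + Σ′ n g
  Σ-+ zero    f g = ≡.refl
  Σ-+ (suc n) f g = ≡.trans (≡.cong (_+_ (f zero + g zero)) (Σ-+ n (f ∘ suc) (g ∘ suc)))
                            (interchange (f zero) (g zero) (Σ′ n (f ∘ suc)) (Σ′ n (g ∘ suc)))
    where
    interchange : ∀ a b c d → (a + b) + (c + d) ≡ (a + c) + (b + d)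
    interchange = solve-∀

  Σ-neg : ∀ n (f : Fin n → ℤ) → Σ′ n (λ i → - f i) ≡ - Σ′ n f
  Σ-neg zero    f = ≡.refl
  Σ-neg (suc n) f = ≡.trans (≡.cong (_+_ (- f zero)) (Σ-neg n (f ∘ suc)))
                            (≡.sym (ℤP.neg-distrib-+ (f zero) (Σ′ n (f ∘ suc))))

  Σ-0 : ∀ n → Σ′ n (λ _ → 0ℤ) ≡ 0ℤ
  Σ-0 zero    = ≡.refl
  Σ-0 (suc n) = ≡.trans (ℤP.+-identityˡ _) (Σ-0 n)

  Σ-δ : ∀ {n} (j : Fin n) → Σ′ n (δ′ j) ≡ 1ℤ
  Σ-δ {suc n} zero    = ≡.cong (_+_ 1ℤ) (Σ-0 n)
  Σ-δ {suc n} (suc j) = ≡.trans (ℤP.+-identityˡ _) (≡.trans (Σ-cong n (δ-suc j)) (Σ-δ j))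
    where
    Σ-cong : ∀ n {f g : Fin n → ℤ} → (∀ i → f i ≡ g i) → Σ′ n f ≡ Σ′ n g
    Σ-cong zero    e = ≡.refl
    Σ-cong (suc n) e = ≡.cong₂ _+_ (e zero) (Σ-cong n (e ∘ suc))

  diff-+ : ∀ m n (f f′ : Fin m → ℤ) (g g′ : Fin n → ℤ) →
    Σ′ m (λ i → f i + f′ i) - Σ′ n (λ i → g i + g′ i) ≡ (Σ′ m f - Σ′ n g) + (Σ′ m f′ - Σ′ n g′)
  diff-+ m n f f′ g g′ = ≡.trans (≡.cong₂ _-_ (Σ-+ m f f′) (Σ-+ n g g′))
                                     (regroup (Σ′ m f) (Σ′ m f′) (Σ′ n g) (Σ′ n g′))
    where
    regroup : ∀ a b c d → (a + b) - (c + d) ≡ (a - c) + (b - d)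
    regroup = solve-∀

  diff-neg : ∀ m n (f : Fin m → ℤ) (g : Fin n → ℤ) →
    Σ′ m (λ i → - f i) - Σ′ n (λ i → - g i) ≡ - (Σ′ m f - Σ′ n g)
  diff-neg m n f g = ≡.trans (≡.cong₂ _-_ (Σ-neg m f) (Σ-neg n g)) (regroup (Σ′ m f) (Σ′ n g))
    where
    regroup : ∀ a c → (- a) - (- c) ≡ - (a - c)
    regroup = solve-∀

  ν-+ : ∀ x y → ν′ (λ v → x v + y v) ≡ ν′ x ⊕ ν′ y
  ν-+ x y = ≡.cong₂ _,_ (diff-+ nR nS _ _ _ _) (diff-+ nC nS _ _ _ _)

  ν-neg : ∀ x → ν′ (λ v → - x v) ≡ ⊝ ν′ x
  ν-neg x = ≡.cong₂ _,_ (diff-neg nR nS _ _) (diff-neg nC nS _ _)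

  ν-0 : ν′ (λ _ → 0ℤ) ≡ (0ℤ , 0ℤ)
  ν-0 = ≡.cong₂ _,_ (≡.cong₂ _-_ (Σ-0 nR) (Σ-0 nS)) (≡.cong₂ _-_ (Σ-0 nC) (Σ-0 nS))

  ν-basis : ∀ v → ν′ (basis v) ≡ degree v
  ν-basis (inj₁ r)        = ≡.cong₂ _,_ (≡.cong₂ _-_ (Σ-δ r) (Σ-0 nS)) (≡.cong₂ _-_ (Σ-0 nC) (Σ-0 nS))
  ν-basis (inj₂ (inj₁ c)) = ≡.cong₂ _,_ (≡.cong₂ _-_ (Σ-0 nR) (Σ-0 nS)) (≡.cong₂ _-_ (Σ-δ c) (Σ-0 nS))
  ν-basis (inj₂ (inj₂ s)) = ≡.cong₂ _,_ (≡.cong₂ _-_ (Σ-0 nR) (Σ-δ s)) (≡.cong₂ _-_ (Σ-0 nC) (Σ-δ s))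

module Evaluation {a ℓ} (nR nC nS : ℕ) (W : Triples nR nC nS) (A : AbelianGroup a ℓ) where
  open AbelianGroup A
  open Multiples A
  open Coordinates nR nC nS W using (δ′; δ-suc; basis)
  open CommutativeMonoidSums commutativeMonoid
    using (sum; sum-cong-≋; ∑-distrib-+; sum-replicate-zero)
  open CommutativeSemigroupProperties commutativeSemigroup using (interchange)
  open GroupMorphisms (AbelianGroup.rawGroup (ℤ^V nR nC nS W)) rawGroup
  open SetoidReasoning setoid

  ΣV : (V nR nC nS → Carrier) → Carrier
  ΣV h = (sum (h ∘ inj₁) ∙ sum (h ∘ inj₂ ∘ inj₁)) ∙ sum (h ∘ inj₂ ∘ inj₂)

  ΣV-cong : ∀ {h k} → (∀ v → h v ≈ k v) → ΣV h ≈ ΣV k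
  ΣV-cong h≈k = ∙-cong (∙-cong (sum-cong-≋ (h≈k ∘ inj₁)) (sum-cong-≋ (h≈k ∘ inj₂ ∘ inj₁)))
                       (sum-cong-≋ (h≈k ∘ inj₂ ∘ inj₂))

  ΣV-∙ : ∀ h k → ΣV (λ v → h v ∙ k v) ≈ ΣV h ∙ ΣV k
  ΣV-∙ h k =
    trans (∙-cong (trans (∙-cong (∑-distrib-+ (h ∘ inj₁) (k ∘ inj₁))
                                 (∑-distrib-+ (h ∘ inj₂ ∘ inj₁) (k ∘ inj₂ ∘ inj₁)))
                         (interchange _ _ _ _))
                  (∑-distrib-+ (h ∘ inj₂ ∘ inj₂) (k ∘ inj₂ ∘ inj₂)))
          (interchange _ _ _ _)

  sift : ∀ {n} (j : Fin n) (g : Fin n → Carrier) → sum (λ i → δ′ j i · g i) ≈ g j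
  sift {suc n} zero    g =
    trans (∙-cong (identityʳ (g zero)) (sum-replicate-zero n)) (identityʳ (g zero))
  sift {suc n} (suc j) g = begin
    ε ∙ sum (λ i → δ′ (suc j) (suc i) · g (suc i))  ≈⟨ identityˡ _ ⟩
    sum (λ i → δ′ (suc j) (suc i) · g (suc i))
      ≈⟨ sum-cong-≋ (λ i → reflexive (≡.cong (_· g (suc i)) (δ-suc j i))) ⟩
    sum (λ i → δ′ j i · g (suc i))                  ≈⟨ sift j (g ∘ suc) ⟩
    g (suc j)                                       ∎

  module _ (f : V nR nC nS → Carrier) where

    ψ : (V nR nC nS → ℤ) → Carrier
    ψ x = ΣV (λ v → x v · f v)

    ψ-hom : IsGroupHomomorphism ψ
    ψ-hom = mkGroupHomomorphism (ℤ^V nR nC nS W) A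
      (λ x≡y → ΣV-cong (λ v → reflexive (≡.cong (_· f v) (x≡y v))))
      (λ x y → trans (ΣV-cong (λ v → ·-homo-+ (x v) (y v) (f v)))
                     (ΣV-∙ (λ v → x v · f v) (λ v → y v · f v)))

    ψ-basis : ∀ v → ψ (basis v) ≈ f v
    ψ-basis (inj₁ r) =
      trans (∙-cong (∙-cong (sift r (f ∘ inj₁)) (sum-replicate-zero nC)) (sum-replicate-zero nS))
            (trans (identityʳ _) (identityʳ _))
    ψ-basis (inj₂ (inj₁ c)) =
      trans (∙-cong (∙-cong (sum-replicate-zero nR) (sift c (f ∘ inj₂ ∘ inj₁))) (sum-replicate-zero nS))
            (trans (identityʳ _) (identityˡ _))
    ψ-basis (inj₂ (inj₂ s)) =
      trans (∙-cong (∙-cong (sum-replicate-zero nR) (sum-replicate-zero nC)) (sift s (f ∘ inj₂ ∘ inj₂)))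
            (trans (∙-congʳ (identityˡ ε)) (identityˡ _))

    ψ-relation : ∀ {r c s} (w : W r c s) →
      ψ (relVec nR nC nS W ((r , c , s) , w)) ≈ (f (inj₁ r) ∙ f (inj₂ (inj₁ c))) ∙ f (inj₂ (inj₂ s))
    ψ-relation {r} {c} {s} w =
      ∙-cong (∙-cong (sift r (f ∘ inj₁)) (sift c (f ∘ inj₂ ∘ inj₁))) (sift s (f ∘ inj₂ ∘ inj₂))

module Translation {a ℓ} (nR nC nS : ℕ) (W : Triples nR nC nS) (A : AbelianGroup a ℓ) where
  open AbelianGroup A
  open GroupProperties group using (∙-cancelʳ)
  open CommutativeMonoidSolver commutativeMonoid using (solve; _⊕_; _⊜_)
  open SetoidReasoning setoid

  shift : Carrier → Carrier → (V nR nC nS → Carrier) → V nR nC nS → Carrier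
  shift α β g (inj₁ r)        = g (inj₁ r) ∙ α ⁻¹
  shift α β g (inj₂ (inj₁ c)) = g (inj₂ (inj₁ c)) ∙ β ⁻¹
  shift α β g (inj₂ (inj₂ s)) = g (inj₂ (inj₂ s)) ∙ (α ∙ β)

  shift-sum : ∀ α β x y z → ((x ∙ α ⁻¹) ∙ (y ∙ β ⁻¹)) ∙ (z ∙ (α ∙ β)) ≈ (x ∙ y) ∙ z
  shift-sum α β x y z = begin
    ((x ∙ α ⁻¹) ∙ (y ∙ β ⁻¹)) ∙ (z ∙ (α ∙ β))
      ≈⟨ solve 7 (λ x y z α β α′ β′ → ((x ⊕ α′) ⊕ (y ⊕ β′)) ⊕ (z ⊕ (α ⊕ β))
                                      ⊜ ((x ⊕ y) ⊕ z) ⊕ ((α′ ⊕ α) ⊕ (β′ ⊕ β)))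
               refl x y z α β (α ⁻¹) (β ⁻¹) ⟩
    ((x ∙ y) ∙ z) ∙ ((α ⁻¹ ∙ α) ∙ (β ⁻¹ ∙ β))  ≈⟨ ∙-congˡ (∙-cong (inverseˡ α) (inverseˡ β)) ⟩
    ((x ∙ y) ∙ z) ∙ (ε ∙ ε)                    ≈⟨ ∙-congˡ (identityˡ ε) ⟩
    ((x ∙ y) ∙ z) ∙ ε                          ≈⟨ identityʳ _ ⟩
    (x ∙ y) ∙ z                                ∎

  shift-embedding : ∀ α β {g} → IsEmbedding nR nC nS W A g →
                    IsEmbedding nR nC nS W A (shift α β g)
  shift-embedding α β emb = record
    { injR = λ r r′ e → injR r r′ (∙-cancelʳ _ _ _ e)
    ; injC = λ c c′ e → injC c c′ (∙-cancelʳ _ _ _ e)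
    ; injS = λ s s′ e → injS s s′ (∙-cancelʳ _ _ _ e)
    ; rel  = λ w → trans (shift-sum α β _ _ _) (rel w)
    }
    where open IsEmbedding emb

inhabited? : ∀ n → Dec (Fin n)
inhabited? zero    = no λ ()
inhabited? (suc n) = yes zero

module Representation {a ℓ} (nR nC nS : ℕ) (W : Triples nR nC nS) (A : AbelianGroup a ℓ)
                      {f : V nR nC nS → AbelianGroup.Carrier A}
                      (emb : IsEmbedding nR nC nS W A f) where
  open AbelianGroup A
  open GroupProperties group using (\\-leftDividesˡ)
  open Coordinates nR nC nS W using (basis; degree; ν′; _⊕_; ⊝_; ν-+; ν-neg; ν-0; ν-basis)
  open Evaluation nR nC nS W A using (ψ; ψ-hom; ψ-basis; ψ-relation)
  open Translation nR nC nS W A using (shift; shift-embedding)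
  open GroupMorphisms.IsGroupHomomorphism (ψ-hom f) using (homo; ε-homo; ⁻¹-homo)

  ψ-relations : ∀ t → ψ f (relVec nR nC nS W t) ≈ ε
  ψ-relations ((r , c , s) , w) = trans (ψ-relation f w) (IsEmbedding.rel emb w)

  𝒜-hom : GroupMorphisms.IsGroupHomomorphism
            (AbelianGroup.rawGroup (𝒜 nR nC nS W)) rawGroup (ψ f)
  𝒜-hom = descend (ℤ^V nR nC nS W) A (ψ-hom f)
                  (genSubgroup (ℤ^V nR nC nS W) (relVec nR nC nS W))
                  (Gen-least (ℤ^V nR nC nS W) (kernel (ℤ^V nR nC nS W) A (ψ-hom f)) ψ-relations)

  𝒞-hom : GroupMorphisms.IsGroupHomomorphism
            (AbelianGroup.rawGroup (𝒞 nR nC nS W)) rawGroup (ψ f ∘ proj₁)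
  𝒞-hom = mkGroupHomomorphism (𝒞 nR nC nS W) A
    (λ {x} {y} → ⟦⟧-cong 𝒜-hom {proj₁ x} {proj₁ y})
    (λ x y → homo 𝒜-hom (proj₁ x) (proj₁ y))
    where open GroupMorphisms.IsGroupHomomorphism

  -- y lifts to degree d when y ≈ ψ f x for some x ∈ ℤ^V with ν x = d;
  -- the elements lifting to degree (0,0) form the image of 𝒞_W.
  Lift : Carrier → ℤ × ℤ → Set ℓ
  Lift y d = Σ (V nR nC nS → ℤ) λ x → ψ f x ≈ y × ν′ x ≡ d

  Lift-resp : ∀ {y y′ d} → y ≈ y′ → Lift y d → Lift y′ d
  Lift-resp y≈y′ (x , ψx≈y , νx≡d) = x , trans ψx≈y y≈y′ , νx≡d

  Lift-ε : Lift ε (0ℤ , 0ℤ)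
  Lift-ε = (λ _ → 0ℤ) , ε-homo , ν-0

  Lift-∙ : ∀ {y y′ d d′} → Lift y d → Lift y′ d′ → Lift (y ∙ y′) (d ⊕ d′)
  Lift-∙ (x , ψx≈y , νx≡d) (x′ , ψx′≈y′ , νx′≡d′) =
    (λ v → x v ℤ.+ x′ v) ,
    trans (homo x x′) (∙-cong ψx≈y ψx′≈y′) ,
    ≡.trans (ν-+ x x′) (≡.cong₂ _⊕_ νx≡d νx′≡d′)

  Lift-⁻¹ : ∀ {y d} → Lift y d → Lift (y ⁻¹) (⊝ d)
  Lift-⁻¹ (x , ψx≈y , νx≡d) =
    (λ v → ℤ.- x v) , trans (⁻¹-homo x) (⁻¹-cong ψx≈y) , ≡.trans (ν-neg x) (≡.cong ⊝_ νx≡d)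

  lift-basis : ∀ v → Lift (f v) (degree v)
  lift-basis v = basis v , ψ-basis f v , ν-basis v

  image : Subgroup A ℓ
  image = record
    { P = λ y → Lift y (0ℤ , 0ℤ) ; resp = Lift-resp ; ε∈ = Lift-ε ; ∙∈ = Lift-∙ ; ⁻¹∈ = Lift-⁻¹ }

  -- Translations (α, β) after which every value of f lies in the image:
  -- α must lift to the degree of each r, β to that of each c, and α ∙ β to
  -- minus that of each s.
  record Recentring : Set (a ⊔ ℓ) where
    field
      α β     : Carrier
      α-lift  : Fin nR → Lift α (1ℤ , 0ℤ)
      β-lift  : Fin nC → Lift β (0ℤ , 1ℤ)
      αβ-lift : Fin nS → Lift (α ∙ β) (1ℤ , 1ℤ)

    shift-in-image : ∀ v → Lift (shift α β f v) (0ℤ , 0ℤ)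
    shift-in-image (inj₁ r)        = Lift-∙ (lift-basis (inj₁ r)) (Lift-⁻¹ (α-lift r))
    shift-in-image (inj₂ (inj₁ c)) = Lift-∙ (lift-basis (inj₂ (inj₁ c))) (Lift-⁻¹ (β-lift c))
    shift-in-image (inj₂ (inj₂ s)) = Lift-∙ (lift-basis (inj₂ (inj₂ s))) (αβ-lift s)

  -- When R or C is empty the corresponding translation is unconstrained
  -- by it; given the other one γ, take its partner γ⁻¹ ∙ (f s₀)⁻¹ for a
  -- fixed s₀ ∈ S, so that the product is (f s₀)⁻¹, of degree (1,1).
  partner : Carrier → Carrier
  partner γ with inhabited? nS
  ... | yes s₀ = γ ⁻¹ ∙ f (inj₂ (inj₂ s₀)) ⁻¹
  ... | no _   = ε

  partner-lift : ∀ γ → Fin nS → Lift (γ ∙ partner γ) (1ℤ , 1ℤ)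
  partner-lift γ s with inhabited? nS
  ... | yes s₀ = Lift-resp (sym (\\-leftDividesˡ γ _)) (Lift-⁻¹ (lift-basis (inj₂ (inj₂ s₀))))
  ... | no ¬S  = ⊥-elim (¬S s)

  recentring : Recentring
  recentring with inhabited? nR | inhabited? nC
  ... | yes r₀ | yes c₀ = record
    { α = f (inj₁ r₀) ; β = f (inj₂ (inj₁ c₀))
    ; α-lift = λ _ → lift-basis (inj₁ r₀) ; β-lift = λ _ → lift-basis (inj₂ (inj₁ c₀))
    ; αβ-lift = λ _ → Lift-∙ (lift-basis (inj₁ r₀)) (lift-basis (inj₂ (inj₁ c₀))) }
  ... | yes r₀ | no ¬C = record
    { α = f (inj₁ r₀) ; β = partner (f (inj₁ r₀))
    ; α-lift = λ _ → lift-basis (inj₁ r₀) ; β-lift = ⊥-elim ∘ ¬C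
    ; αβ-lift = partner-lift (f (inj₁ r₀)) }
  ... | no ¬R | yes c₀ = record
    { α = partner (f (inj₂ (inj₁ c₀))) ; β = f (inj₂ (inj₁ c₀))
    ; α-lift = ⊥-elim ∘ ¬R ; β-lift = λ _ → lift-basis (inj₂ (inj₁ c₀))
    ; αβ-lift = Lift-resp (comm _ _) ∘ partner-lift (f (inj₂ (inj₁ c₀))) }
  ... | no ¬R | no ¬C = record
    { α = ε ; β = partner ε ; α-lift = ⊥-elim ∘ ¬R ; β-lift = ⊥-elim ∘ ¬C
    ; αβ-lift = partner-lift ε }

  -- If f is part of a minimal representation, ψ f maps 𝒞_W onto A: the
  -- recentred embedding generates A and takes values in the image.
  onto : (∀ g → IsEmbedding nR nC nS W A g → Generates A g) →
         ∀ y → Σ (AbelianGroup.Carrier (𝒞 nR nC nS W)) λ x → ψ f (proj₁ x) ≈ y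
  onto minimal y = let x , ψx≈y , νx≡0 = lifted in (x , νx≡0) , ψx≈y
    where
    open Recentring recentring
    lifted : Lift y (0ℤ , 0ℤ)
    lifted = Gen-least A image shift-in-image (minimal _ (shift-embedding α β emb) y)

theorem4 : ∀ {a ℓ b ℓ′ : Level} (nR nC nS : ℕ) (W : Triples nR nC nS) →
    IsPartialLatinSquare nR nC nS W →
    Σ (AbelianGroup b ℓ′) (λ B → EmbedsIn nR nC nS W B) →
    (A : AbelianGroup a ℓ) → IsMinimalRepresentation nR nC nS W A →
    Σ (Subgroup (𝒞 nR nC nS W) ℓ) (λ N →
      Σ (AbelianGroup.Carrier (quotient (𝒞 nR nC nS W) N) → AbelianGroup.Carrier A) (λ φ →
        GroupMorphisms.IsGroupIsomorphism
          (AbelianGroup.rawGroup (quotient (𝒞 nR nC nS W) N))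
          (AbelianGroup.rawGroup A) φ))
theorem4 nR nC nS W _ _ A ((f , emb) , minimal) =
  kernel (𝒞 nR nC nS W) A 𝒞-hom , ψ f ∘ proj₁ ,
  firstIsomorphism (𝒞 nR nC nS W) A 𝒞-hom (onto minimal)
  where
  open Evaluation nR nC nS W A using (ψ)
  open Representation nR nC nS W A emb using (𝒞-hom; onto)
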